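{- Let $k\in\mathbb{Z}^+$. Then every power of $2$ is $k$-universal, and hence the set $\{\binom nk:\ n\in\mathbb{N}\}$ is a dense subset of the ring $\mathbb{Z}_2$ of $2$-adic integers.
   Context: For $k\in\mathbb{N}=\{0,1,2,\ldots\}$ and $m\in\mathbb{Z}^+$ let $R_m(k)=\{\binom nk \bmod m:\ n\in\mathbb{N}\}$; $m$ is called $k$-universal if $R_m(k)=\mathbb{Z}/m\mathbb{Z}$. -}

module Defs where

open import Data.Nat using (ℕ; _<_; _%_; NonZero)
open import Data.Nat.Combinatorics using (_C_)
open import Data.Product using (∃-syntax)
open import Relation.Binary.PropositionalEquality using (_≡_)

KUniversal : (k m : ℕ) → .{{NonZero m}} → Set
KUniversal k m = ∀ r → r < m → ∃[ n ] ((n C k) % m ≡ r)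

-- Write k = 2^e + s with s < 2^e and let N = 2^(e+j). A binomial coefficient C(2^P, d) with 0 < d
-- is divisible by 2^(P − v₂(d)), so in Vandermonde's expansion of C(N + n, t) modulo 2^(j+1) only
-- the terms with d = 0 and d = 2^e survive:
--   C(N + n, k) ≡ C(n, k) + C(N, 2^e)·C(n, s)   and   C(N + n, s) ≡ C(n, s),
-- where C(N, 2^e) = 2^j·(odd). Hence, as long as C(n, s) is odd, replacing n by N + n flips the j-th
-- binary digit of C(n, k) and keeps the lower ones; by induction on j, starting from n = s, every
-- residue modulo 2^j is attained.
module Submission where

open import Defs
open import Data.Nat
open import Data.Nat.Properties
open import Data.Nat.Combinatorics using (_C_; nCk+nC[k+1]≡[n+1]C[k+1]; nC1≡n; nCn≡1)
open import Data.Nat.Divisibility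
  using (_∣_; _∤_; divides; _∣0; 1∣_; ∣-trans; m∣m*n; m*n∣⇒m∣; *-monoʳ-∣; *-cancelˡ-∣; ∣m+n∣m⇒∣n; ∣m∣n⇒∣m+n; ∣m⇒∣m*n)
open import Data.Nat.DivMod using ([m+kn]%n≡m%n; m<n⇒m%n≡m)
open import Data.Nat.Primality using (prime[2]; euclidsLemma)
open import Data.Nat.Tactic.RingSolver using (solve-∀)
open import Data.Product using (∃; ∃₂; _×_; _,_)
open import Data.Sum using (_⊎_; inj₁; inj₂)
open import Function.Base using (_∘_)
open import Level using (0ℓ)
open import Relation.Binary.Bundles using (Setoid)
open import Relation.Binary.Structures using (IsEquivalence)
open import Relation.Binary.PropositionalEquality
import Relation.Binary.Reasoning.Setoid as ≈-Reasoning
open import Relation.Nullary using (contradiction)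

-- Pascal's recursion; unlike _C_ it computes by pattern matching, which the inductions below rely on.
infix 7.5 _choose_
_choose_ : ℕ → ℕ → ℕ
n     choose zero  = 1
zero  choose suc k = 0
suc n choose suc k = n choose k + n choose suc k

choose≡C : ∀ n k → n choose k ≡ n C k
choose≡C n       zero    = refl
choose≡C zero    (suc k) = refl
choose≡C (suc n) (suc k) =
  trans (cong₂ _+_ (choose≡C n k) (choose≡C n (suc k))) (nCk+nC[k+1]≡[n+1]C[k+1] n k)

absorption-suc : ∀ n k → suc k * (suc n choose suc k) ≡ suc n * (n choose k)
absorption-suc n       zero    = begin
  1 * (suc n choose 1)  ≡⟨ *-identityˡ _ ⟩
  suc n choose 1        ≡⟨ trans (choose≡C (suc n) 1) (nC1≡n (suc n)) ⟩
  suc n                 ≡⟨ *-identityʳ (suc n) ⟨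
  suc n * 1             ∎
  where open ≡-Reasoning
absorption-suc zero    (suc k) = *-zeroʳ (2 + k)
absorption-suc (suc n) (suc k) = begin
  (2 + k) * (a + b)              ≡⟨ expand k a b ⟩
  (1 + k) * a + a + (2 + k) * b  ≡⟨ cong₂ (λ x y → x + a + y) (absorption-suc n k) (absorption-suc n (suc k)) ⟩
  (1 + n) * c + a + (1 + n) * d  ≡⟨ collect n c d ⟩
  (2 + n) * a                    ∎
  where
  open ≡-Reasoning
  a b c d : ℕ
  a = suc n choose suc k
  b = suc n choose suc (suc k)
  c = n choose k
  d = n choose suc k
  expand : ∀ k a b → (2 + k) * (a + b) ≡ (1 + k) * a + a + (2 + k) * b
  expand = solve-∀
  collect : ∀ n c d → (1 + n) * c + (c + d) + (1 + n) * d ≡ (2 + n) * (c + d)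
  collect = solve-∀

absorption : ∀ n d .{{_ : NonZero n}} .{{_ : NonZero d}} → d * (n choose d) ≡ n * (pred n choose pred d)
absorption (suc n) (suc d) = absorption-suc n d

∑ : ℕ → (ℕ → ℕ) → ℕ
∑ zero    f = 0
∑ (suc n) f = f 0 + ∑ n (f ∘ suc)

∑-zero : ∀ n → ∑ n (λ _ → 0) ≡ 0
∑-zero zero    = refl
∑-zero (suc n) = ∑-zero n

∑-cong : ∀ n {f g} → (∀ i → f i ≡ g i) → ∑ n f ≡ ∑ n g
∑-cong zero    f≗g = refl
∑-cong (suc n) f≗g = cong₂ _+_ (f≗g 0) (∑-cong n (f≗g ∘ suc))

∑-+ : ∀ n f g → ∑ n (λ i → f i + g i) ≡ ∑ n f + ∑ n g
∑-+ zero    f g = refl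
∑-+ (suc n) f g = begin
  f 0 + g 0 + ∑ n (λ i → f (suc i) + g (suc i))  ≡⟨ cong (f 0 + g 0 +_) (∑-+ n (f ∘ suc) (g ∘ suc)) ⟩
  f 0 + g 0 + (∑ n (f ∘ suc) + ∑ n (g ∘ suc))    ≡⟨ +-assoc-comm (f 0) (g 0) _ _ ⟩
  f 0 + ∑ n (f ∘ suc) + (g 0 + ∑ n (g ∘ suc))    ∎
  where
  open ≡-Reasoning
  +-assoc-comm : ∀ a b c d → a + b + (c + d) ≡ a + c + (b + d)
  +-assoc-comm = solve-∀

∑-split : ∀ m n f → ∑ (m + n) f ≡ ∑ m f + ∑ n (λ i → f (m + i))
∑-split zero    n f = refl
∑-split (suc m) n f = trans (cong (f 0 +_) (∑-split m n (f ∘ suc))) (sym (+-assoc (f 0) _ _))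

vandermonde : ∀ m n k → (m + n) choose k ≡ ∑ (suc k) (λ i → m choose i * n choose (k ∸ i))
vandermonde zero    n k = sym (trans (cong₂ _+_ (*-identityˡ (n choose k)) (∑-zero k)) (+-identityʳ _))
vandermonde (suc m) n zero    = refl
vandermonde (suc m) n (suc k) = begin
  (m + n) choose k + (m + n) choose suc k  ≡⟨ cong₂ _+_ (vandermonde m n k) (vandermonde m n (suc k)) ⟩
  L + (n choose suc k + 0 + R)             ≡⟨ rearrange L (n choose suc k) R ⟩
  1 * n choose suc k + (L + R)             ≡⟨ cong (1 * n choose suc k +_) (sym (∑-+ (suc k) f g)) ⟩
  1 * n choose suc k + ∑ (suc k) (λ i → f i + g i)
    ≡⟨ cong (1 * n choose suc k +_) (∑-cong (suc k) λ i → sym (*-distribʳ-+ (n choose (k ∸ i)) (m choose i) (m choose suc i))) ⟩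
  1 * n choose suc k + ∑ (suc k) (λ i → suc m choose suc i * n choose (k ∸ i))  ∎
  where
  open ≡-Reasoning
  f g : ℕ → ℕ
  f i = m choose i * n choose (k ∸ i)
  g i = m choose suc i * n choose (k ∸ i)
  L R : ℕ
  L = ∑ (suc k) f
  R = ∑ (suc k) g
  rearrange : ∀ l c r → l + (c + 0 + r) ≡ 1 * c + (l + r)
  rearrange = solve-∀

-- Witnessed by a + x m = b + y m, so that no subtraction is needed.
infix 4 _≡_mod_
_≡_mod_ : ℕ → ℕ → ℕ → Set
a ≡ b mod m = ∃₂ λ x y → a + x * m ≡ b + y * m

module _ {m : ℕ} where

  ≡mod-reflexive : ∀ {a b} → a ≡ b → a ≡ b mod m
  ≡mod-reflexive refl = 0 , 0 , refl

  ≡mod-refl : ∀ {a} → a ≡ a mod m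
  ≡mod-refl = ≡mod-reflexive refl

  ≡mod-sym : ∀ {a b} → a ≡ b mod m → b ≡ a mod m
  ≡mod-sym (x , y , eq) = y , x , sym eq

  ≡mod-trans : ∀ {a b c} → a ≡ b mod m → b ≡ c mod m → a ≡ c mod m
  ≡mod-trans {a} {b} {c} (x , y , eq₁) (x′ , y′ , eq₂) = x + x′ , y′ + y , (begin
    a + (x + x′) * m    ≡⟨ split a x x′ ⟩
    a + x * m + x′ * m  ≡⟨ cong (_+ x′ * m) eq₁ ⟩
    b + y * m + x′ * m  ≡⟨ swap b (y * m) (x′ * m) ⟩
    b + x′ * m + y * m  ≡⟨ cong (_+ y * m) eq₂ ⟩
    c + y′ * m + y * m  ≡⟨ split c y′ y ⟨
    c + (y′ + y) * m    ∎)
    where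
    open ≡-Reasoning
    split : ∀ a x y → a + (x + y) * m ≡ a + x * m + y * m
    split a x y = trans (cong (a +_) (*-distribʳ-+ m x y)) (sym (+-assoc a _ _))
    swap : ∀ a p q → a + p + q ≡ a + q + p
    swap = solve-∀

  ≡mod-+ : ∀ {a b c d} → a ≡ b mod m → c ≡ d mod m → a + c ≡ b + d mod m
  ≡mod-+ {a} {b} {c} {d} (x , y , eq₁) (x′ , y′ , eq₂) = x + x′ , y + y′ , (begin
    a + c + (x + x′) * m          ≡⟨ shuffle a c x x′ m ⟩
    (a + x * m) + (c + x′ * m)    ≡⟨ cong₂ _+_ eq₁ eq₂ ⟩
    (b + y * m) + (d + y′ * m)    ≡⟨ shuffle b d y y′ m ⟨
    b + d + (y + y′) * m          ∎)
    where
    open ≡-Reasoning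
    shuffle : ∀ a c x y m → a + c + (x + y) * m ≡ (a + x * m) + (c + y * m)
    shuffle = solve-∀

  ≡mod-* : ∀ {a b c d} → a ≡ b mod m → c ≡ d mod m → a * c ≡ b * d mod m
  ≡mod-* {a} {b} {c} {d} (x , y , eq₁) (x′ , y′ , eq₂) =
    a * x′ + x * c + x * x′ * m , b * y′ + y * d + y * y′ * m , (begin
    a * c + (a * x′ + x * c + x * x′ * m) * m  ≡⟨ expand a c x x′ m ⟩
    (a + x * m) * (c + x′ * m)                 ≡⟨ cong₂ _*_ eq₁ eq₂ ⟩
    (b + y * m) * (d + y′ * m)                 ≡⟨ expand b d y y′ m ⟨
    b * d + (b * y′ + y * d + y * y′ * m) * m  ∎)
    where
    open ≡-Reasoning
    expand : ∀ a c x y m → a * c + (a * y + x * c + x * y * m) * m ≡ (a + x * m) * (c + y * m)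
    expand = solve-∀

  +-multiple-≡mod : ∀ a {c} → m ∣ c → a + c ≡ a mod m
  +-multiple-≡mod a (divides q refl) = 0 , q , +-identityʳ _

  ≡mod⇒%≡ : ∀ {a b} .{{_ : NonZero m}} → a ≡ b mod m → a % m ≡ b % m
  ≡mod⇒%≡ {a} {b} (x , y , eq) = begin
    a % m            ≡⟨ [m+kn]%n≡m%n a x m ⟨
    (a + x * m) % m  ≡⟨ cong (_% m) eq ⟩
    (b + y * m) % m  ≡⟨ [m+kn]%n≡m%n b y m ⟩
    b % m            ∎
    where open ≡-Reasoning

≡mod-isEquivalence : ∀ m → IsEquivalence (_≡_mod m)
≡mod-isEquivalence m = record { refl = ≡mod-refl ; sym = ≡mod-sym ; trans = ≡mod-trans }

≡mod-setoid : ℕ → Setoid 0ℓ 0ℓ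
≡mod-setoid m = record { isEquivalence = ≡mod-isEquivalence m }

≡mod-1 : ∀ a b → a ≡ b mod 1
≡mod-1 a b = b , a , trans (cong (a +_) (*-identityʳ b)) (trans (+-comm a b) (cong (b +_) (sym (*-identityʳ a))))

≡mod-∣ : ∀ {d m a b} → d ∣ m → a ≡ b mod m → a ≡ b mod d
≡mod-∣ {d} {a = a} {b} (divides q refl) (x , y , eq) =
  x * q , y * q , trans (cong (a +_) (*-assoc x q d)) (trans eq (cong (b +_) (sym (*-assoc y q d))))

data ParityView : ℕ → Set where
  even : ∀ q → ParityView (q * 2)
  odd  : ∀ q → ParityView (1 + q * 2)

parityView : ∀ n → ParityView n
parityView zero = even 0
parityView (suc n) with parityView n
... | even q = odd q
... | odd  q = even (suc q)

Odd : ℕ → Set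
Odd n = n ≡ 1 mod 2

odd-1+q*2 : ∀ q → Odd (1 + q * 2)
odd-1+q*2 q = 0 , q , +-identityʳ _

odd⇒2∤ : ∀ {n} → Odd n → 2 ∤ n
odd⇒2∤ (x , y , eq) (divides q refl) =
  even≢odd (q + x) y (trans (*-comm 2 (q + x)) (trans (*-distribʳ-+ 2 q x) (trans eq (cong suc (*-comm y 2)))))

≡mod-halve : ∀ {m a b} → a ≡ b mod m → a ≡ b mod 2 * m ⊎ a + m ≡ b mod 2 * m
≡mod-halve {m} {a} {b} (x , y , eq) with parityView x | parityView y
... | even x′ | even y′ = inj₁ (x′ , y′ , trans (sym (regroup a x′)) (trans eq (regroup b y′)))
  where
  regroup : ∀ c z → c + z * 2 * m ≡ c + z * (2 * m)
  regroup c z = cong (c +_) (*-assoc z 2 m)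
... | odd x′  | odd y′  = inj₁ (x′ , y′ , +-cancelˡ-≡ m _ _ (trans (shift m a x′) (trans eq (sym (shift m b y′)))))
  where
  shift : ∀ m c z → m + (c + z * (2 * m)) ≡ c + (m + z * 2 * m)
  shift = solve-∀
... | odd x′  | even y′ = inj₂ (x′ , y′ , trans (shift m a x′) (trans eq (regroup m b y′)))
  where
  shift : ∀ m c z → c + m + z * (2 * m) ≡ c + (m + z * 2 * m)
  shift = solve-∀
  regroup : ∀ m c z → c + z * 2 * m ≡ c + z * (2 * m)
  regroup = solve-∀
... | even x′ | odd y′  = inj₂ (x′ , suc y′ , trans (shift m a x′) (trans (cong (_+ m) eq) (carry m b y′)))
  where
  shift : ∀ m c z → c + m + z * (2 * m) ≡ c + z * 2 * m + m
  shift = solve-∀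
  carry : ∀ m c z → c + (m + z * 2 * m) + m ≡ c + suc z * (2 * m)
  carry = solve-∀

∑-∣ : ∀ n {m f} → (∀ i → i < n → m ∣ f i) → m ∣ ∑ n f
∑-∣ zero    _    = _ ∣0
∑-∣ (suc n) m∣fᵢ = ∣m∣n⇒∣m+n (m∣fᵢ 0 z<s) (∑-∣ n λ i i<n → m∣fᵢ (suc i) (s<s i<n))

∑-≡mod-head : ∀ n {m f} .{{_ : NonZero n}} → (∀ i → 0 < i → i < n → m ∣ f i) → ∑ n f ≡ f 0 mod m
∑-≡mod-head (suc n) {f = f} m∣fᵢ = +-multiple-≡mod (f 0) (∑-∣ n λ i i<n → m∣fᵢ (suc i) z<s (s<s i<n))

*-odd-≡mod : ∀ m {v} → Odd v → m * v ≡ m mod 2 * m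
*-odd-≡mod m {v} (x , y , eq) = x , y , trans (distrib m v x) (trans (cong (m *_) eq) (undistrib m y))
  where
  distrib : ∀ m v x → m * v + x * (2 * m) ≡ m * (v + x * 2)
  distrib = solve-∀
  undistrib : ∀ m y → m * (1 + y * 2) ≡ m + y * (2 * m)
  undistrib = solve-∀

odd⇒nonZero : ∀ {u} → Odd u → NonZero u
odd⇒nonZero {zero}  odd-u = contradiction (divides 0 refl) (odd⇒2∤ odd-u)
odd⇒nonZero {suc u} _     = _

odd∧<2⇒≡1 : ∀ {u} → Odd u → u < 2 → u ≡ 1
odd∧<2⇒≡1 {0}     odd-0 _ = contradiction (divides 0 refl) (odd⇒2∤ odd-0)
odd∧<2⇒≡1 {1}     _     _ = refl
odd∧<2⇒≡1 {2+ u} _ (s<s (s<s ()))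

pow2∣odd*n⇒pow2∣n : ∀ M {u c} → Odd u → 2 ^ M ∣ u * c → 2 ^ M ∣ c
pow2∣odd*n⇒pow2∣n zero    {c = c} _     _ = 1∣ c
pow2∣odd*n⇒pow2∣n (suc M) {u} {c} odd-u 2^M*2∣uc with euclidsLemma u c prime[2] (m*n∣⇒m∣ 2 (2 ^ M) 2^M*2∣uc)
... | inj₁ 2∣u = contradiction 2∣u (odd⇒2∤ odd-u)
... | inj₂ (divides q refl) = subst (2 * 2 ^ M ∣_) (*-comm 2 q) (*-monoʳ-∣ 2 2^M∣q)
  where
  regroup : ∀ u q → u * (q * 2) ≡ 2 * (u * q)
  regroup = solve-∀
  2^M∣q : 2 ^ M ∣ q
  2^M∣q = pow2∣odd*n⇒pow2∣n M odd-u (*-cancelˡ-∣ 2 (subst (2 * 2 ^ M ∣_) (regroup u q) 2^M*2∣uc))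

-- Absorption d·C(2^(a+M), d) = 2^(a+M)·C(2^(a+M) − 1, d − 1) with d = 2^a·u;
-- cancel 2^a, then the odd factor u.
pow2-∣-choose-pow2*odd : ∀ a M {u} → Odd u → 2 ^ M ∣ 2 ^ (a + M) choose (2 ^ a * u)
pow2-∣-choose-pow2*odd a M {u} odd-u = pow2∣odd*n⇒pow2∣n M odd-u (divides (pred N choose pred d) u*C≡2^M*C′)
  where
  N d : ℕ
  N = 2 ^ (a + M)
  d = 2 ^ a * u
  instance
    2^a≢0 : NonZero (2 ^ a)
    2^a≢0 = m^n≢0 2 a
    N≢0 : NonZero N
    N≢0 = m^n≢0 2 (a + M)
    d≢0 : NonZero d
    d≢0 = m*n≢0 (2 ^ a) u {{2^a≢0}} {{odd⇒nonZero odd-u}}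
  u*C≡2^M*C′ : u * (N choose d) ≡ pred N choose pred d * 2 ^ M
  u*C≡2^M*C′ = *-cancelˡ-≡ _ _ (2 ^ a) (begin
    2 ^ a * (u * (N choose d))          ≡⟨ *-assoc (2 ^ a) u _ ⟨
    d * (N choose d)                    ≡⟨ absorption N d ⟩
    N * (pred N choose pred d)          ≡⟨ cong (_* (pred N choose pred d)) (^-distribˡ-+-* 2 a M) ⟩
    2 ^ a * 2 ^ M * (pred N choose pred d)  ≡⟨ regroup (2 ^ a) (2 ^ M) _ ⟩
    2 ^ a * (pred N choose pred d * 2 ^ M)  ∎)
    where
    open ≡-Reasoning
    regroup : ∀ x y z → x * y * z ≡ x * (z * y)
    regroup = solve-∀

pow2-∣-pow2 : ∀ {m n} → m ≤ n → 2 ^ m ∣ 2 ^ n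
pow2-∣-pow2 {m} m≤n with m≤n⇒∃[o]m+o≡n m≤n
... | o , refl = subst (2 ^ m ∣_) (sym (^-distribˡ-+-* 2 m o)) (m∣m*n (2 ^ o))

odd-part : ∀ e {d} → 0 < d → d < 2 ^ e → ∃₂ λ a u → a < e × Odd u × d ≡ 2 ^ a * u
odd-part zero    {suc d} _ (s<s ())
odd-part (suc e) {d} 0<d d<2^[1+e] with parityView d
... | odd q  = 0 , d , z<s , odd-1+q*2 q , sym (*-identityˡ d)
... | even (suc q) with odd-part e {suc q} z<s q<2^e
  where
  q<2^e : suc q < 2 ^ e
  q<2^e = *-cancelʳ-< 2 (suc q) (2 ^ e) (subst (suc q * 2 <_) (*-comm 2 (2 ^ e)) d<2^[1+e])
...   | a , u , a<e , odd-u , q≡2^a*u = suc a , u , s<s a<e , odd-u , trans (cong (_* 2) q≡2^a*u) (regroup (2 ^ a) u)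
  where
  regroup : ∀ x u → x * u * 2 ≡ 2 * x * u
  regroup = solve-∀

pow2-∣-choose : ∀ e j {d} → 0 < d → d < 2 ^ suc e → d ≢ 2 ^ e → 2 ^ suc j ∣ 2 ^ (e + j) choose d
pow2-∣-choose e j {d} 0<d d<2^[1+e] d≢2^e with odd-part (suc e) 0<d d<2^[1+e]
... | a , u , a<1+e , odd-u , d≡2^a*u with m<1+n⇒m<n∨m≡n a<1+e
...   | inj₁ a<e = subst (λ n → 2 ^ suc j ∣ 2 ^ n choose d) exponent (∣-trans (pow2-∣-pow2 1+j≤M) 2^M∣C)
  where
  M : ℕ
  M = e ∸ a + j
  2^M∣C : 2 ^ M ∣ 2 ^ (a + M) choose d
  2^M∣C = subst (λ x → 2 ^ M ∣ 2 ^ (a + M) choose x) (sym d≡2^a*u) (pow2-∣-choose-pow2*odd a M odd-u)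
  exponent : a + M ≡ e + j
  exponent = trans (sym (+-assoc a (e ∸ a) j)) (cong (_+ j) (m+[n∸m]≡n (<⇒≤ a<e)))
  1+j≤M : suc j ≤ M
  1+j≤M = +-monoˡ-≤ j (m<n⇒0<n∸m a<e)
...   | inj₂ refl = contradiction (trans d≡2^a*u (trans (cong (2 ^ a *_) u≡1) (*-identityʳ (2 ^ a)))) d≢2^e
  where
  u<2 : u < 2
  u<2 = *-cancelˡ-< (2 ^ a) u 2 (subst₂ _<_ d≡2^a*u (*-comm 2 (2 ^ a)) d<2^[1+e])
  u≡1 : u ≡ 1
  u≡1 = odd∧<2⇒≡1 odd-u u<2

odd∧2∣+⇒odd : ∀ {a b} → Odd a → 2 ∣ a + b → Odd b
odd∧2∣+⇒odd {a} {b} odd-a 2∣a+b with parityView b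
... | odd q  = odd-1+q*2 q
... | even q = contradiction (∣m+n∣m⇒∣n (subst (2 ∣_) (+-comm a (q * 2)) 2∣a+b) (divides q refl)) (odd⇒2∤ odd-a)

odd-choose-pow2-pred : ∀ P {n} → suc n ≡ 2 ^ P → ∀ i → i ≤ n → Odd (n choose i)
odd-choose-pow2-pred P     eq zero    _     = ≡mod-refl
odd-choose-pow2-pred P {n} eq (suc i) 1+i≤n =
  odd∧2∣+⇒odd (odd-choose-pow2-pred P eq i (≤-trans (n≤1+n i) 1+i≤n)) 2∣[1+n]C[1+i]
  where
  1+i<2^P : suc i < 2 ^ P
  1+i<2^P = subst (suc i <_) eq (s≤s 1+i≤n)
  2∣[1+n]C[1+i] : 2 ∣ suc n choose suc i
  2∣[1+n]C[1+i] = subst (λ N → 2 ∣ N choose suc i) (trans (cong (2 ^_) (+-identityʳ P)) (sym eq))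
    (pow2-∣-choose P 0 z<s (<-trans 1+i<2^P (^-monoʳ-< 2 (s<s z<s) (n<1+n P))) (<⇒≢ 1+i<2^P))

pow2-choose-pow2 : ∀ e j → ∃ λ u → Odd u × 2 ^ (e + j) choose 2 ^ e ≡ 2 ^ j * u
pow2-choose-pow2 e j = pred N choose pred K , odd-u , N-choose-K
  where
  N K : ℕ
  N = 2 ^ (e + j)
  K = 2 ^ e
  instance
    N≢0 : NonZero N
    N≢0 = m^n≢0 2 (e + j)
    K≢0 : NonZero K
    K≢0 = m^n≢0 2 e
  odd-u : Odd (pred N choose pred K)
  odd-u = odd-choose-pow2-pred (e + j) (suc-pred N) (pred K) (pred-mono-≤ (^-monoʳ-≤ 2 (m≤m+n e j)))
  N-choose-K : N choose K ≡ 2 ^ j * (pred N choose pred K)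
  N-choose-K = *-cancelˡ-≡ _ _ K (begin
    K * (N choose K)                     ≡⟨ absorption N K ⟩
    N * (pred N choose pred K)           ≡⟨ cong (_* (pred N choose pred K)) (^-distribˡ-+-* 2 e j) ⟩
    K * 2 ^ j * (pred N choose pred K)   ≡⟨ *-assoc K (2 ^ j) _ ⟩
    K * (2 ^ j * (pred N choose pred K)) ∎)
    where open ≡-Reasoning

module _ (e j n : ℕ) where

  private
    N K : ℕ
    N = 2 ^ (e + j)
    K = 2 ^ e
    K<2K : K < 2 ^ suc e
    K<2K = ^-monoʳ-< 2 (s<s z<s) (n<1+n e)

  choose-shift-low : ∀ {t} → t < K → (N + n) choose t ≡ n choose t mod 2 ^ suc j
  choose-shift-low {t} t<K = begin
    (N + n) choose t  ≡⟨ vandermonde N n t ⟩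
    ∑ (suc t) g       ≈⟨ ∑-≡mod-head (suc t) positive ⟩
    g 0               ≡⟨ *-identityˡ _ ⟩
    n choose t        ∎
    where
    open ≈-Reasoning (≡mod-setoid (2 ^ suc j))
    g : ℕ → ℕ
    g i = N choose i * n choose (t ∸ i)
    positive : ∀ i → 0 < i → i < suc t → 2 ^ suc j ∣ g i
    positive i 0<i i<1+t = ∣m⇒∣m*n _ (pow2-∣-choose e j 0<i (<-trans i<K K<2K) (<⇒≢ i<K))
      where
      i<K : i < K
      i<K = ≤-<-trans (m<1+n⇒m≤n i<1+t) t<K

  choose-shift-high : ∀ {t} → t < K → (N + n) choose (K + t) ≡ n choose (K + t) + N choose K * n choose t mod 2 ^ suc j
  choose-shift-high {t} t<K = begin
    (N + n) choose (K + t)                         ≡⟨ vandermonde N n (K + t) ⟩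
    ∑ (suc (K + t)) g                              ≡⟨ cong (λ m → ∑ m g) (+-suc K t) ⟨
    ∑ (K + suc t) g                                ≡⟨ ∑-split K (suc t) g ⟩
    ∑ K g + ∑ (suc t) (g ∘ (K +_))                 ≈⟨ ≡mod-+ (∑-≡mod-head K below-K) (∑-≡mod-head (suc t) above-K) ⟩
    g 0 + g (K + 0)                                ≡⟨ cong₂ _+_ (*-identityˡ _) (cong g (+-identityʳ K)) ⟩
    n choose (K + t) + N choose K * n choose (K + t ∸ K)  ≡⟨ cong (λ m → n choose (K + t) + N choose K * n choose m) (m+n∸m≡n K t) ⟩
    n choose (K + t) + N choose K * n choose t     ∎
    where
    open ≈-Reasoning (≡mod-setoid (2 ^ suc j))
    instance
      K≢0 : NonZero K
      K≢0 = m^n≢0 2 e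
    g : ℕ → ℕ
    g i = N choose i * n choose (K + t ∸ i)
    below-K : ∀ i → 0 < i → i < K → 2 ^ suc j ∣ g i
    below-K i 0<i i<K = ∣m⇒∣m*n _ (pow2-∣-choose e j 0<i (<-trans i<K K<2K) (<⇒≢ i<K))
    above-K : ∀ i → 0 < i → i < suc t → 2 ^ suc j ∣ g (K + i)
    above-K i 0<i i<1+t = ∣m⇒∣m*n _ (pow2-∣-choose e j (<-≤-trans 0<i (m≤n+m i K)) K+i<2K (>⇒≢ (m<m+n K 0<i)))
      where
      K+i<2K : K + i < 2 ^ suc e
      K+i<2K = subst (K + i <_) (cong (K +_) (sym (+-identityʳ K))) (+-monoʳ-< K (≤-<-trans (m<1+n⇒m≤n i<1+t) t<K))

leading-pow2 : ∀ k → 0 < k → ∃₂ λ e s → s < 2 ^ e × k ≡ 2 ^ e + s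
leading-pow2 1             _ = 0 , 0 , z<s , refl
leading-pow2 (suc (suc k)) _ with leading-pow2 (suc k) z<s
... | e , s , s<2^e , 1+k≡2^e+s with m≤n⇒m<n∨m≡n s<2^e
...   | inj₁ 1+s<2^e = e , suc s , 1+s<2^e , trans (cong suc 1+k≡2^e+s) (sym (+-suc (2 ^ e) s))
...   | inj₂ 1+s≡2^e = suc e , 0 , m^n>0 2 (suc e) , (begin
  suc (suc k)      ≡⟨ cong suc 1+k≡2^e+s ⟩
  suc (2 ^ e + s)  ≡⟨ +-suc (2 ^ e) s ⟨
  2 ^ e + suc s    ≡⟨ cong (2 ^ e +_) 1+s≡2^e ⟩
  2 ^ e + 2 ^ e    ≡⟨ cong (2 ^ e +_) (+-identityʳ (2 ^ e)) ⟨
  2 ^ suc e        ≡⟨ +-identityʳ (2 ^ suc e) ⟨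
  2 ^ suc e + 0    ∎)
  where open ≡-Reasoning

module _ {e s : ℕ} (s<2^e : s < 2 ^ e) where

  choose-hits-every-residue : ∀ j r → ∃ λ n → n choose (2 ^ e + s) ≡ r mod 2 ^ j × Odd (n choose s)
  choose-hits-every-residue zero    r = s , ≡mod-1 _ r , ≡mod-reflexive (trans (choose≡C s s) (nCn≡1 s))
  choose-hits-every-residue (suc j) r with choose-hits-every-residue j r
  ... | n , ≡r , odd-s with ≡mod-halve ≡r
  ...   | inj₁ ≡r′   = n , ≡r′ , odd-s
  ...   | inj₂ +2^j≡r = N + n , ≡mod-trans shifted +2^j≡r , odd-s′
    where
    N K : ℕ
    N = 2 ^ (e + j)
    K = 2 ^ e
    open ≈-Reasoning (≡mod-setoid (2 ^ suc j))
    shifted : (N + n) choose (K + s) ≡ n choose (K + s) + 2 ^ j mod 2 ^ suc j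
    shifted with pow2-choose-pow2 e j
    ... | u , odd-u , N-choose-K = begin
      (N + n) choose (K + s)                         ≈⟨ choose-shift-high e j n s<2^e ⟩
      n choose (K + s) + N choose K * n choose s     ≡⟨ cong (λ c → n choose (K + s) + c * n choose s) N-choose-K ⟩
      n choose (K + s) + 2 ^ j * u * n choose s      ≡⟨ cong (n choose (K + s) +_) (*-assoc (2 ^ j) u _) ⟩
      n choose (K + s) + 2 ^ j * (u * n choose s)    ≈⟨ ≡mod-+ ≡mod-refl (*-odd-≡mod (2 ^ j) (≡mod-* odd-u odd-s)) ⟩
      n choose (K + s) + 2 ^ j                       ∎
    odd-s′ : Odd ((N + n) choose s)
    odd-s′ = ≡mod-trans (≡mod-∣ (m∣m*n (2 ^ j)) (choose-shift-low e j n s<2^e)) odd-s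

corollary1p2 : (k : ℕ) → 0 < k → (j : ℕ) → KUniversal k (2 ^ j) {{m^n≢0 2 j}}
corollary1p2 k 0<k j r r<2^j with leading-pow2 k 0<k
... | e , s , s<2^e , refl with choose-hits-every-residue {e} s<2^e j r
... | n , ≡r , _ = n , (begin
  (n C k) % 2 ^ j     ≡⟨ cong (_% 2 ^ j) (choose≡C n k) ⟨
  n choose k % 2 ^ j  ≡⟨ ≡mod⇒%≡ ≡r ⟩
  r % 2 ^ j           ≡⟨ m<n⇒m%n≡m r<2^j ⟩
  r                   ∎)
  where
  instance
    2^j≢0 : NonZero (2 ^ j)
    2^j≢0 = m^n≢0 2 j
  open ≡-Reasoning
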